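{- Let $r\ge 4$ and let $G$ be a $K_r^-$-minor free graph on $n$ vertices. Suppose $A,B\subseteq V(G)$ are disjoint sets with $|A|=r-3$, $|B|=(1-\delta)n$ and $(1-3\delta)n>r$ (for some $\delta\ge0$), such that every vertex of $A$ is adjacent to every vertex of $B$. Let $G^*$ be the graph obtained from $G$ by adding all missing edges inside $A$ so that $A$ becomes a clique. Then $G^*$ is also $K_r^-$-minor free.
   Context: All graphs are finite and simple. $K_r^-$ is the graph obtained from $K_r$ by deleting one edge. A graph $H$ is a minor of $G$ if $H$ can be obtained from $G$ by vertex deletions, edge deletions and edge contractions; $G$ is $H$-minor free if it has no $H$ minor. -}

module Defs where

open import Level using (0ℓ)
open import Data.Nat using (ℕ; zero; suc)
open import Data.Fin using (Fin; toℕ)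
open import Data.Fin.Subset using (Subset; _∈_)
open import Data.Product using (_×_; _,_; ∃; ∃-syntax)
open import Data.Sum using (_⊎_; inj₁; inj₂)
open import Data.Empty using (⊥)
open import Relation.Nullary using (¬_)
open import Relation.Binary.PropositionalEquality using (_≡_; _≢_; refl; sym)
open import Data.Integer using (+_)
open import Data.Rational using (ℚ; _/_)

record Graph (n : ℕ) : Set₁ where
  field
    Adj    : Fin n → Fin n → Set
    adj-sym    : ∀ {u v} → Adj u v → Adj v u
    adj-irrefl : ∀ {u} → ¬ Adj u u
open Graph public

data WalkIn {n : ℕ} (G : Graph n) (S : Fin n → Set) : Fin n → Fin n → Set where
  here : ∀ {u} → S u → WalkIn G S u u
  step : ∀ {u w v} → S u → Adj G u w → WalkIn G S w v → WalkIn G S u v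

Connected : {n : ℕ} → Graph n → (Fin n → Set) → Set
Connected G S = ∀ u v → S u → S v → WalkIn G S u v

record MinorModel {m n : ℕ} (H : Graph m) (G : Graph n) : Set₁ where
  field
    branch    : Fin m → Fin n → Set
    nonempty  : ∀ i → ∃[ v ] branch i v
    connected : ∀ i → Connected G (branch i)
    disjoint  : ∀ i j v → i ≢ j → branch i v → branch j v → ⊥
    edges     : ∀ i j → Adj H i j → ∃[ u ] ∃[ v ] (branch i u × branch j v × Adj G u v)

_≼_ : {m n : ℕ} → Graph m → Graph n → Set₁
H ≼ G = MinorModel H G

KAdj : (r : ℕ) → Fin r → Fin r → Set
KAdj r u v = u ≢ v × ¬ (toℕ u ≡ 0 × toℕ v ≡ 1) × ¬ (toℕ u ≡ 1 × toℕ v ≡ 0)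

Kminus : (r : ℕ) → Graph r
Kminus r = record
  { Adj = KAdj r
  ; adj-sym = λ { (ne , a , b) → (λ e → ne (sym e)) , (λ { (x , y) → b (y , x) }) , (λ { (x , y) → a (y , x) }) }
  ; adj-irrefl = λ { (ne , _) → ne refl }
  }

AddClique : {n : ℕ} → Graph n → Subset n → Graph n
AddClique {n} G A = record
  { Adj = λ u v → Adj G u v ⊎ (u ∈ A × v ∈ A × u ≢ v)
  ; adj-sym = λ { (inj₁ e) → inj₁ (Graph.adj-sym G e) ; (inj₂ (a , b , ne)) → inj₂ (b , a , λ e → ne (sym e)) }
  ; adj-irrefl = λ { (inj₁ e) → Graph.adj-irrefl G e ; (inj₂ (_ , _ , ne)) → ne refl }
  }

ℕ→ℚ : ℕ → ℚ
ℕ→ℚ k = + k / 1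

module Submission where

-- Let M be a K_r^- model in G* and call a branch set free if it contains no vertex of A.  The r − 2
-- branch sets other than 0 and 1 cannot all meet A, as |A| = r − 3; fix a free one, X_l.  Let R be
-- the set of vertices reachable from X_l in G − A.  As X_l touches every other branch set, R contains
-- every free branch set.
-- If R has at most two vertices in B, then |B ∖ R| ≥ |A| and each a ∈ A gets a private vertex
-- f a ∈ B ∖ R.  Replacing every branch set X by (X ∩ (A ∪ R)) ∪ f(X ∩ A) gives a model in G: a
-- vertex of X ∩ R reaches A inside X along edges of G, and since A is complete to B the vertices
-- of X ∩ A are all joined through f a₀ for one of them.
-- If R has three vertices in B, walks in R between them yield three disjoint connected A-free
-- cells Y₁ — Y₃ — Y₂, each with exactly one vertex in B.  With r − 3 disjoint edges a b, a ∈ A and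
-- b ∈ B outside the cells, they form a K_r^- model in G, Y₁ and Y₂ being its non-adjacent pair.
-- The hypotheses on δ serve only to give |B| > r.

open import Defs
open import Function using (_∘_; case_of_)
open import Data.Nat as ℕ using (ℕ; zero; suc; _+_; _∸_; _≤_; _<_; s≤s; _≤?_)
import Data.Nat.Properties as ℕₚ
open import Data.Fin using (Fin; zero; suc; inject≤; _≟_)
import Data.Fin.Properties as Finₚ
open import Data.Fin.Subset using (Subset; inside; outside; _∈_; _∉_; ∣_∣; _∩_; _─_; _-_; ⁅_⁆)
open import Data.Fin.Subset.Properties using (_∈?_; p─q⊆p; x∈p∩q⁻; ∣p∩q∣≤∣q∣; ∣⁅x⁆∣≡1; x∈⁅x⁆)
open import Data.Vec.Base using ([]; _∷_; tabulate; here; there)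
open import Data.Vec.Properties using ([]=⇒lookup; lookup⇒[]=; lookup∘tabulate)
open import Data.List using (List; []; _∷_)
open import Data.List.Membership.Propositional using () renaming (_∈_ to _∈ₗ_)
import Data.List.Relation.Unary.Any as Any
open import Data.Product using (Σ; ∃-syntax; _×_; _,_; proj₁; proj₂)
open import Data.Sum using (_⊎_; inj₁; inj₂)
open import Data.Empty using (⊥; ⊥-elim)
open import Relation.Nullary using (¬_; Dec; yes; no; does; ¬?; _×-dec_)
open import Relation.Nullary.Decidable using (dec-true; dec-false; decidable-stable; ¬¬-excluded-middle)
open import Relation.Binary.PropositionalEquality using (_≡_; _≢_; refl; sym; trans; cong; subst; subst₂)
import Data.Nat.Coprimality as Coprime
open import Data.Integer as ℤ using (+_)
import Data.Integer.Properties as ℤₚ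
open import Data.Rational using (ℚ; 0ℚ; 1ℚ; mkℚ; *≤*; NonNegative; nonNegative)
  renaming (_≤_ to _≤ℚ_; _<_ to _<ℚ_; _*_ to _*ℚ_; _-_ to _-ℚ_)
import Data.Rational.Properties as ℚₚ

-- Adjacency is not decidable, so decisions about branch sets and reachability are only available
-- under a double negation; this suffices as the conclusion is a negation.
¬¬-decide-Fin : ∀ {m} (P : Fin m → Set) → ¬ ¬ (∀ i → Dec (P i))
¬¬-decide-Fin {zero} P k = k (λ ())
¬¬-decide-Fin {suc m} P k = ¬¬-excluded-middle λ P₀? →
  ¬¬-decide-Fin (P ∘ suc) λ P? → k λ { zero → P₀? ; (suc i) → P? i }

module _ {n : ℕ} {P : Fin n → Set} (P? : ∀ v → Dec (P v)) where

  toSubset : Subset n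
  toSubset = tabulate (does ∘ P?)

  ∈toSubset⁺ : ∀ {v} → P v → v ∈ toSubset
  ∈toSubset⁺ {v} p = lookup⇒[]= v toSubset (trans (lookup∘tabulate _ v) (dec-true (P? v) p))

  ∈toSubset⁻ : ∀ {v} → v ∈ toSubset → P v
  ∈toSubset⁻ {v} v∈ = decidable-stable (P? v) λ ¬p →
    case trans (sym ([]=⇒lookup v∈)) (trans (lookup∘tabulate _ v) (dec-false (P? v) ¬p)) of λ ()

select : ∀ {n} (p : Subset n) → Fin ∣ p ∣ → Fin n
select (inside ∷ p) zero = zero
select (inside ∷ p) (suc i) = suc (select p i)
select (outside ∷ p) i = suc (select p i)

select-∈ : ∀ {n} (p : Subset n) i → select p i ∈ p
select-∈ (inside ∷ p) zero = here
select-∈ (inside ∷ p) (suc i) = there (select-∈ p i)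
select-∈ (outside ∷ p) i = there (select-∈ p i)

select-injective : ∀ {n} (p : Subset n) {i j} → select p i ≡ select p j → i ≡ j
select-injective (inside ∷ p) {zero} {zero} _ = refl
select-injective (inside ∷ p) {suc i} {suc j} eq = cong suc (select-injective p (Finₚ.suc-injective eq))
select-injective (outside ∷ p) eq = select-injective p (Finₚ.suc-injective eq)

rank : ∀ {n} (p : Subset n) {x} → x ∈ p → Fin ∣ p ∣
rank (inside ∷ p) here = zero
rank (inside ∷ p) (there x∈p) = suc (rank p x∈p)
rank (outside ∷ p) (there x∈p) = rank p x∈p

rank-injective : ∀ {n} (p : Subset n) {x y} (x∈p : x ∈ p) (y∈p : y ∈ p) → rank p x∈p ≡ rank p y∈p → x ≡ y
rank-injective (inside ∷ p) here here _ = refl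
rank-injective (inside ∷ p) (there x∈p) (there y∈p) eq = cong suc (rank-injective p x∈p y∈p (Finₚ.suc-injective eq))
rank-injective (outside ∷ p) (there x∈p) (there y∈p) eq = cong suc (rank-injective p x∈p y∈p eq)

embed : ∀ {n} (p : Subset n) {m} → m ≤ ∣ p ∣ → Fin m → Fin n
embed p m≤∣p∣ i = select p (inject≤ i m≤∣p∣)

embed-∈ : ∀ {n} (p : Subset n) {m} (m≤∣p∣ : m ≤ ∣ p ∣) i → embed p m≤∣p∣ i ∈ p
embed-∈ p m≤∣p∣ i = select-∈ p (inject≤ i m≤∣p∣)

embed-injective : ∀ {n} (p : Subset n) {m} (m≤∣p∣ : m ≤ ∣ p ∣) {i j} → embed p m≤∣p∣ i ≡ embed p m≤∣p∣ j → i ≡ j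
embed-injective p m≤∣p∣ eq = Finₚ.inject≤-injective m≤∣p∣ m≤∣p∣ _ _ (select-injective p eq)

injective⇒≤∣p∣ : ∀ {n} (p : Subset n) {m} (f : Fin m → Fin n) → (∀ i → f i ∈ p) → (∀ {i j} → f i ≡ f j → i ≡ j) → m ≤ ∣ p ∣
injective⇒≤∣p∣ p f f∈p f-inj = Finₚ.injective⇒≤ (f-inj ∘ rank-injective p (f∈p _) (f∈p _))

∣p∣≡∣p∩q∣+∣p─q∣ : ∀ {n} (p q : Subset n) → ∣ p ∣ ≡ ∣ p ∩ q ∣ + ∣ p ─ q ∣
∣p∣≡∣p∩q∣+∣p─q∣ [] [] = refl
∣p∣≡∣p∩q∣+∣p─q∣ (inside ∷ p) (inside ∷ q) = cong suc (∣p∣≡∣p∩q∣+∣p─q∣ p q)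
∣p∣≡∣p∩q∣+∣p─q∣ (inside ∷ p) (outside ∷ q) = trans (cong suc (∣p∣≡∣p∩q∣+∣p─q∣ p q)) (sym (ℕₚ.+-suc _ _))
∣p∣≡∣p∩q∣+∣p─q∣ (outside ∷ p) (inside ∷ q) = ∣p∣≡∣p∩q∣+∣p─q∣ p q
∣p∣≡∣p∩q∣+∣p─q∣ (outside ∷ p) (outside ∷ q) = ∣p∣≡∣p∩q∣+∣p─q∣ p q

∣p∣≤1+∣p-x∣ : ∀ {n} (p : Subset n) x → ∣ p ∣ ≤ suc ∣ p - x ∣
∣p∣≤1+∣p-x∣ p x = ℕₚ.≤-trans (ℕₚ.≤-reflexive (∣p∣≡∣p∩q∣+∣p─q∣ p ⁅ x ⁆))
  (ℕₚ.+-monoˡ-≤ ∣ p - x ∣ (ℕₚ.≤-trans (∣p∩q∣≤∣q∣ p ⁅ x ⁆) (ℕₚ.≤-reflexive (∣⁅x⁆∣≡1 x))))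

x∈p─q⇒x∉q : ∀ {n} {p q : Subset n} {x} → x ∈ p ─ q → x ∉ q
x∈p─q⇒x∉q {p = inside ∷ p} {outside ∷ q} here ()
x∈p─q⇒x∉q {p = _ ∷ p} {_ ∷ q} (there x∈) (there x∈q) = x∈p─q⇒x∉q x∈ x∈q

x∈p-y⇒x≢y : ∀ {n} {p : Subset n} {x y} → x ∈ p - y → x ≢ y
x∈p-y⇒x≢y {y = y} x∈ refl = x∈p─q⇒x∉q x∈ (x∈⁅x⁆ y)

Disjoint : ∀ {n} → (Fin n → Set) → (Fin n → Set) → Set
Disjoint X Y = ∀ v → X v → Y v → ⊥

Touch : ∀ {n} → Graph n → (Fin n → Set) → (Fin n → Set) → Set
Touch G X Y = ∃[ u ] ∃[ v ] X u × Y v × Adj G u v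

Disjoint-sym : ∀ {n} {X Y : Fin n → Set} → Disjoint X Y → Disjoint Y X
Disjoint-sym X∩Y=∅ v y x = X∩Y=∅ v x y

Touch-sym : ∀ {n} (G : Graph n) {X Y : Fin n → Set} → Touch G X Y → Touch G Y X
Touch-sym G (u , v , x , y , u~v) = v , u , y , x , adj-sym G u~v

module _ {n : ℕ} {G : Graph n} where

  walk-start : ∀ {P u v} → WalkIn G P u v → P u
  walk-start (here p) = p
  walk-start (step p _ _) = p

  walk-end : ∀ {P u v} → WalkIn G P u v → P v
  walk-end (here p) = p
  walk-end (step _ _ w) = walk-end w

  walk-map : ∀ {P Q : Fin n → Set} → (∀ {v} → P v → Q v) → ∀ {u v} → WalkIn G P u v → WalkIn G Q u v
  walk-map f (here p) = here (f p)
  walk-map f (step p e w) = step (f p) e (walk-map f w)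

  walk-++ : ∀ {P u v w} → WalkIn G P u v → WalkIn G P v w → WalkIn G P u w
  walk-++ (here _) w₂ = w₂
  walk-++ (step p e w₁) w₂ = step p e (walk-++ w₁ w₂)

  walk-snoc : ∀ {P u v w} → WalkIn G P u v → Adj G v w → P w → WalkIn G P u w
  walk-snoc w e p = walk-++ w (step (walk-end w) e (here p))

  walk-reverse : ∀ {P u v} → WalkIn G P u v → WalkIn G P v u
  walk-reverse (here p) = here p
  walk-reverse (step p e w) = walk-snoc (walk-reverse w) (adj-sym G e) p

  vertices : ∀ {P u v} → WalkIn G P u v → List (Fin n)
  vertices {u = u} (here _) = u ∷ []
  vertices {u = u} (step _ _ w) = u ∷ vertices w

  ∈vertices⇒P : ∀ {P u v x} (w : WalkIn G P u v) → x ∈ₗ vertices w → P x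
  ∈vertices⇒P (here p) (Any.here refl) = p
  ∈vertices⇒P (step p _ _) (Any.here refl) = p
  ∈vertices⇒P (step _ _ w) (Any.there x∈w) = ∈vertices⇒P w x∈w

  start∈vertices : ∀ {P u v} (w : WalkIn G P u v) → u ∈ₗ vertices w
  start∈vertices (here _) = Any.here refl
  start∈vertices (step _ _ _) = Any.here refl

  end∈vertices : ∀ {P u v} (w : WalkIn G P u v) → v ∈ₗ vertices w
  end∈vertices (here _) = Any.here refl
  end∈vertices (step _ _ w) = Any.there (end∈vertices w)

  walk-suffix : ∀ {P u v x} (w : WalkIn G P u v) → x ∈ₗ vertices w → WalkIn G (_∈ₗ vertices w) x v
  walk-suffix (here _) (Any.here refl) = here (Any.here refl)
  walk-suffix (step _ e w) (Any.here refl) = step (Any.here refl) e (walk-map Any.there (walk-suffix w (start∈vertices w)))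
  walk-suffix (step _ _ w) (Any.there x∈w) = walk-map Any.there (walk-suffix w x∈w)

  vertices-connected : ∀ {P u v} (w : WalkIn G P u v) → Connected G (_∈ₗ vertices w)
  vertices-connected w x y x∈w y∈w = walk-++ (walk-suffix w x∈w) (walk-reverse (walk-suffix w y∈w))

edge-connected : ∀ {n} (G : Graph n) {a b} → Adj G a b → Connected G (λ v → v ≡ a ⊎ v ≡ b)
edge-connected G a~b _ _ (inj₁ refl) (inj₁ refl) = here (inj₁ refl)
edge-connected G a~b _ _ (inj₁ refl) (inj₂ refl) = step (inj₁ refl) a~b (here (inj₂ refl))
edge-connected G a~b _ _ (inj₂ refl) (inj₁ refl) = step (inj₂ refl) (adj-sym G a~b) (here (inj₁ refl))
edge-connected G a~b _ _ (inj₂ refl) (inj₂ refl) = here (inj₂ refl)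

module _ {n : ℕ} (G : Graph n) (A : Subset n) where

  addClique-edge : ∀ {u v} → u ∉ A → Adj (AddClique G A) u v → Adj G u v
  addClique-edge u∉A (inj₁ u~v) = u~v
  addClique-edge u∉A (inj₂ (u∈A , _)) = ⊥-elim (u∉A u∈A)

  addClique-walk : ∀ {P u v} → (∀ {x} → P x → x ∉ A) → WalkIn (AddClique G A) P u v → WalkIn G P u v
  addClique-walk P∉A (here p) = here p
  addClique-walk P∉A (step p e w) = step p (addClique-edge (P∉A p) e) (addClique-walk P∉A w)

ArmVertex : ∀ {n} (S P T : Fin n → Set) → Fin n → Fin n → Set
ArmVertex S P T q v = v ≡ q ⊎ (S v × ¬ P v × ¬ T v)

module _ {n : ℕ} (G : Graph n) (S P T : Fin n → Set) where

  record Bridge : Set where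
    field
      source tip target : Fin n
      source-S : S source
      source-P : P source
      source-T : ¬ T source
      target-S : S target
      target-T : T target
      arm : WalkIn G (ArmVertex S P T source) source tip
      tip~target : Adj G tip target

  module _ (P? : ∀ v → Dec (P v)) (T? : ∀ v → Dec (T v)) where

    -- The arm is the stretch of the walk after its last P-vertex before it first enters T.
    bridge-extending : ∀ {q y z} → S q → P q → ¬ T q →
      WalkIn G (ArmVertex S P T q) q y → WalkIn G S y z → T z → Bridge
    bridge-extending _ _ ¬tq arm (here _) tz with walk-end arm
    ... | inj₁ refl = ⊥-elim (¬tq tz)
    ... | inj₂ (_ , _ , ¬tz) = ⊥-elim (¬tz tz)
    bridge-extending sq pq ¬tq arm (step {w = m} _ y~m rest) tz with T? m | P? m
    ... | yes tm | _ = record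
      { source-S = sq ; source-P = pq ; source-T = ¬tq ; target-S = walk-start rest ; target-T = tm
      ; arm = arm ; tip~target = y~m }
    ... | no ¬tm | yes pm = bridge-extending (walk-start rest) pm ¬tm (here (inj₁ refl)) rest tz
    ... | no ¬tm | no ¬pm = bridge-extending sq pq ¬tq (walk-snoc arm y~m (inj₂ (walk-start rest , ¬pm , ¬tm))) rest tz

    bridge : ∀ {x z} → P x → ¬ T x → WalkIn G S x z → T z → Bridge
    bridge px ¬tx w = bridge-extending (walk-start w) px ¬tx (here (inj₁ refl)) w

module _ {n : ℕ} (G : Graph n) (A B : Subset n) where

  open import Data.List.Membership.DecPropositional (_≟_ {n = n}) using () renaming (_∈?_ to _∈ₗ?_)

  record Cell (Y : Fin n → Set) : Set where
    field
      root : Fin n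
      root∈Y : Y root
      root∈B : root ∈ B
      connected : Connected G Y
      avoids-A : ∀ {v} → Y v → v ∉ A
      unique-root : ∀ {v} → Y v → v ∈ B → v ≡ root

  Arm : (T : Fin n → Set) → Fin n → Fin n → Set
  Arm = ArmVertex (_∉ A) (_∈ B)

  Arm-∉A : ∀ {T q v} → q ∉ A → Arm T q v → v ∉ A
  Arm-∉A q∉A (inj₁ refl) = q∉A
  Arm-∉A q∉A (inj₂ (v∉A , _)) = v∉A

  Arm-∈B : ∀ {T q v} → Arm T q v → v ∈ B → v ≡ q
  Arm-∈B (inj₁ v≡q) _ = v≡q
  Arm-∈B (inj₂ (_ , v∉B , _)) v∈B = ⊥-elim (v∉B v∈B)

  arm-cell : ∀ {T q y} → q ∉ A → q ∈ B → (arm : WalkIn G (Arm T q) q y) → Cell (_∈ₗ vertices arm)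
  arm-cell {T} q∉A q∈B arm = record
    { root∈Y = start∈vertices arm ; root∈B = q∈B ; connected = vertices-connected arm
    ; avoids-A = Arm-∉A {T} q∉A ∘ ∈vertices⇒P arm
    ; unique-root = Arm-∈B {T} ∘ ∈vertices⇒P arm }

  record CellPath : Set₁ where
    field
      Y₁ Y₂ Y₃ : Fin n → Set
      cell₁ : Cell Y₁
      cell₂ : Cell Y₂
      cell₃ : Cell Y₃
      disjoint₁₂ : Disjoint Y₁ Y₂
      disjoint₁₃ : Disjoint Y₁ Y₃
      disjoint₂₃ : Disjoint Y₂ Y₃
      touch₁₃ : Touch G Y₁ Y₃
      touch₂₃ : Touch G Y₂ Y₃

  cellPath : ∀ {X Y Z} → Cell X → Cell Y → Cell Z → Disjoint X Y → Disjoint X Z → Disjoint Y Z →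
    Touch G Y Z → Touch G X Y ⊎ Touch G X Z → CellPath
  cellPath X Y Z X∩Y X∩Z Y∩Z Y~Z (inj₁ X~Y) = record
    { cell₁ = X ; cell₂ = Z ; cell₃ = Y ; disjoint₁₂ = X∩Z ; disjoint₁₃ = X∩Y ; disjoint₂₃ = Disjoint-sym Y∩Z
    ; touch₁₃ = X~Y ; touch₂₃ = Touch-sym G Y~Z }
  cellPath X Y Z X∩Y X∩Z Y∩Z Y~Z (inj₂ X~Z) = record
    { cell₁ = X ; cell₂ = Y ; cell₃ = Z ; disjoint₁₂ = X∩Y ; disjoint₁₃ = X∩Z ; disjoint₂₃ = Y∩Z
    ; touch₁₃ = X~Z ; touch₂₃ = Y~Z }

  -- u₀ — arm₁ — u joins two B-vertices; a third B-vertex w is bridged to L = u ∪ arm₁,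
  -- and whichever of u and arm₁ the bridge reaches becomes the middle cell.
  cellPath-from-segment : ∀ {T₁} (seg : Bridge G (_∉ A) (_∈ B) T₁) → let open Bridge seg in
    source ≢ target → target ∈ B → ∀ {w} → w ∈ B → w ≢ source → w ≢ target →
    WalkIn G (_∉ A) w source → CellPath
  cellPath-from-segment {T₁} seg u₀≢u u∈B {w} w∈B w≢u₀ w≢u w⇝u₀ =
    cellPath X-cell Y-cell Z-cell X∩Y X∩Z Y∩Z Y~Z (attach-touch (Bridge.target-T attach))
    where
    open Bridge seg renaming (source to u₀; target to u; arm to arm₁)
    L : List (Fin n)
    L = u ∷ vertices arm₁
    w∉L : ¬ w ∈ₗ L
    w∉L (Any.here w≡u) = w≢u w≡u
    w∉L (Any.there w∈arm₁) = w≢u₀ (Arm-∈B {T₁} (∈vertices⇒P arm₁ w∈arm₁) w∈B)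
    attach : Bridge G (_∉ A) (_∈ B) (_∈ₗ L)
    attach = bridge G _ _ _ (_∈? B) (_∈ₗ? L) w∈B w∉L w⇝u₀ (Any.there (start∈vertices arm₁))
    open Bridge attach using () renaming (arm to arm₂; source-T to q∉L; tip~target to tip₂~p)
    X-cell : Cell (_∈ₗ vertices arm₂)
    X-cell = arm-cell (Bridge.source-S attach) (Bridge.source-P attach) arm₂
    Y-cell : Cell (_∈ₗ vertices arm₁)
    Y-cell = arm-cell source-S source-P arm₁
    Z-cell : Cell (_∈ₗ u ∷ [])
    Z-cell = arm-cell {T₁} target-S u∈B (here (inj₁ refl))
    X∉L : ∀ {v} → v ∈ₗ vertices arm₂ → ¬ v ∈ₗ L
    X∉L v∈X with ∈vertices⇒P arm₂ v∈X
    ... | inj₁ refl = q∉L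
    ... | inj₂ (_ , _ , v∉L) = v∉L
    X∩Y : Disjoint (_∈ₗ vertices arm₂) (_∈ₗ vertices arm₁)
    X∩Y v v∈X v∈Y = X∉L v∈X (Any.there v∈Y)
    X∩Z : Disjoint (_∈ₗ vertices arm₂) (_∈ₗ u ∷ [])
    X∩Z v v∈X (Any.here v≡u) = X∉L v∈X (Any.here v≡u)
    Y∩Z : Disjoint (_∈ₗ vertices arm₁) (_∈ₗ u ∷ [])
    Y∩Z v v∈Y (Any.here refl) = u₀≢u (sym (Arm-∈B {T₁} (∈vertices⇒P arm₁ v∈Y) u∈B))
    Y~Z : Touch G (_∈ₗ vertices arm₁) (_∈ₗ u ∷ [])
    Y~Z = _ , _ , end∈vertices arm₁ , Any.here refl , tip~target
    attach-touch : Bridge.target attach ∈ₗ L →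
      Touch G (_∈ₗ vertices arm₂) (_∈ₗ vertices arm₁) ⊎ Touch G (_∈ₗ vertices arm₂) (_∈ₗ u ∷ [])
    attach-touch (Any.here p≡u) = inj₂ (_ , _ , end∈vertices arm₂ , Any.here p≡u , tip₂~p)
    attach-touch (Any.there p∈Y) = inj₁ (_ , _ , end∈vertices arm₂ , p∈Y , tip₂~p)

  cellPath-in-region : ∀ {R : Fin n → Set} → (∀ {x y} → R x → R y → WalkIn G (_∉ A) x y) →
    (b : Fin 3 → Fin n) → (∀ {i j} → b i ≡ b j → i ≡ j) → (∀ i → b i ∈ B) → (∀ i → R (b i)) → CellPath
  cellPath-in-region R-walk b b-inj b∈B b∈R = third-vertex (b i₁ ≟ target)
    where
    i₀ i₁ i₂ : Fin 3
    i₀ = zero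
    i₁ = suc zero
    i₂ = suc (suc zero)
    T₁ : Fin n → Set
    T₁ v = v ∈ B × v ≢ b i₀
    seg : Bridge G (_∉ A) (_∈ B) T₁
    seg = bridge G _ _ _ (_∈? B) (λ v → (v ∈? B) ×-dec ¬? (v ≟ b i₀)) (b∈B i₀) (λ (_ , b₀≢b₀) → b₀≢b₀ refl)
      (R-walk (b∈R i₀) (b∈R i₁)) (b∈B i₁ , λ e → case b-inj e of λ ())
    open Bridge seg
    u₀≡b₀ : source ≡ b i₀
    u₀≡b₀ = decidable-stable (source ≟ b i₀) (λ u₀≢b₀ → source-T (source-P , u₀≢b₀))
    from : ∀ i → b i ≢ b i₀ → b i ≢ target → CellPath
    from i bᵢ≢b₀ bᵢ≢u = cellPath-from-segment seg (λ e → proj₂ target-T (trans (sym e) u₀≡b₀)) (proj₁ target-T)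
      (b∈B i) (λ e → bᵢ≢b₀ (trans e u₀≡b₀)) bᵢ≢u
      (subst (WalkIn G (_∉ A) (b i)) (sym u₀≡b₀) (R-walk (b∈R i) (b∈R i₀)))
    third-vertex : Dec (b i₁ ≡ target) → CellPath
    third-vertex (yes b₁≡u) = from i₂ (λ e → case b-inj e of λ ()) (λ e → case b-inj (trans e (sym b₁≡u)) of λ ())
    third-vertex (no b₁≢u) = from i₁ (λ e → case b-inj e of λ ()) b₁≢u

-- Three B-vertices in R: a model built from three cells and r − 3 edges

module _ {n : ℕ} {G : Graph n} {A B : Subset n}
         (A∩B=∅ : Disjoint (_∈ A) (_∈ B)) (A~B : ∀ {a b} → a ∈ A → b ∈ B → Adj G a b) where

  Pair : Fin n → Fin n → Fin n → Set
  Pair a b v = v ≡ a ⊎ v ≡ b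

  cell-Pair-disjoint : ∀ {Y a b} (c : Cell G A B Y) → a ∈ A → b ∈ B → b ≢ Cell.root c → Disjoint Y (Pair a b)
  cell-Pair-disjoint c a∈A _ _ _ y (inj₁ refl) = Cell.avoids-A c y a∈A
  cell-Pair-disjoint c _ b∈B b≢root _ y (inj₂ refl) = b≢root (Cell.unique-root c y b∈B)

  cell-Pair-touch : ∀ {Y a b} (c : Cell G A B Y) → a ∈ A → Touch G Y (Pair a b)
  cell-Pair-touch c a∈A = _ , _ , Cell.root∈Y c , inj₁ refl , adj-sym G (A~B a∈A (Cell.root∈B c))

  module CellPathModel {k : ℕ} (∣A∣≡1+k : ∣ A ∣ ≡ suc k) (3+∣A∣≤∣B∣ : 3 + ∣ A ∣ ≤ ∣ B ∣) (P : CellPath G A B) where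

    open CellPath P

    β₁ β₂ β₃ : Fin n
    β₁ = Cell.root cell₁
    β₂ = Cell.root cell₂
    β₃ = Cell.root cell₃

    T : Subset n
    T = B - β₁ - β₂ - β₃

    1+k≤∣T∣ : suc k ≤ ∣ T ∣
    1+k≤∣T∣ = ℕₚ.+-cancelˡ-≤ 3 _ _ (begin
      3 + suc k            ≡⟨ cong (λ x → 3 + x) ∣A∣≡1+k ⟨
      3 + ∣ A ∣            ≤⟨ 3+∣A∣≤∣B∣ ⟩
      ∣ B ∣                ≤⟨ ∣p∣≤1+∣p-x∣ B β₁ ⟩
      1 + ∣ B - β₁ ∣       ≤⟨ s≤s (∣p∣≤1+∣p-x∣ (B - β₁) β₂) ⟩
      2 + ∣ B - β₁ - β₂ ∣  ≤⟨ s≤s (s≤s (∣p∣≤1+∣p-x∣ (B - β₁ - β₂) β₃)) ⟩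
      3 + ∣ T ∣            ∎)
      where open ℕₚ.≤-Reasoning

    k<∣A∣ : suc k ≤ ∣ A ∣
    k<∣A∣ = ℕₚ.≤-reflexive (sym ∣A∣≡1+k)
    a b : Fin (suc k) → Fin n
    a = embed A k<∣A∣
    b = embed T 1+k≤∣T∣

    a∈A : ∀ i → a i ∈ A
    a∈A = embed-∈ A k<∣A∣

    b∈T : ∀ i → b i ∈ T
    b∈T = embed-∈ T 1+k≤∣T∣

    b∈B : ∀ i → b i ∈ B
    b∈B i = p─q⊆p _ _ (p─q⊆p _ _ (p─q⊆p _ _ (b∈T i)))

    b≢β₁ : ∀ i → b i ≢ β₁
    b≢β₁ i = x∈p-y⇒x≢y (p─q⊆p _ _ (p─q⊆p _ _ (b∈T i)))

    b≢β₂ : ∀ i → b i ≢ β₂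
    b≢β₂ i = x∈p-y⇒x≢y (p─q⊆p _ _ (b∈T i))

    b≢β₃ : ∀ i → b i ≢ β₃
    b≢β₃ i = x∈p-y⇒x≢y (b∈T i)

    branch : Fin (4 + k) → Fin n → Set
    branch zero = Y₁
    branch (suc zero) = Y₂
    branch (suc (suc zero)) = Y₃
    branch (suc (suc (suc i))) = Pair (a i) (b i)

    nonempty : ∀ i → ∃[ v ] branch i v
    nonempty zero = _ , Cell.root∈Y cell₁
    nonempty (suc zero) = _ , Cell.root∈Y cell₂
    nonempty (suc (suc zero)) = _ , Cell.root∈Y cell₃
    nonempty (suc (suc (suc i))) = _ , inj₁ refl

    connected : ∀ i → Connected G (branch i)
    connected zero = Cell.connected cell₁
    connected (suc zero) = Cell.connected cell₂
    connected (suc (suc zero)) = Cell.connected cell₃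
    connected (suc (suc (suc i))) = edge-connected G (A~B (a∈A i) (b∈B i))

    pairs-disjoint : ∀ {i j} → i ≢ j → Disjoint (Pair (a i) (b i)) (Pair (a j) (b j))
    pairs-disjoint i≢j _ (inj₁ refl) (inj₁ e) = i≢j (embed-injective A k<∣A∣ e)
    pairs-disjoint {i} {j} _ v (inj₁ refl) (inj₂ e) = A∩B=∅ v (a∈A i) (subst (_∈ B) (sym e) (b∈B j))
    pairs-disjoint {i} {j} _ v (inj₂ refl) (inj₁ e) = A∩B=∅ v (subst (_∈ A) (sym e) (a∈A j)) (b∈B i)
    pairs-disjoint i≢j _ (inj₂ refl) (inj₂ e) = i≢j (embed-injective T 1+k≤∣T∣ e)

    disjoint : ∀ i j v → i ≢ j → branch i v → branch j v → ⊥
    disjoint zero zero _ i≢j _ _ = i≢j refl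
    disjoint zero (suc zero) v _ = disjoint₁₂ v
    disjoint zero (suc (suc zero)) v _ = disjoint₁₃ v
    disjoint zero (suc (suc (suc j))) v _ = cell-Pair-disjoint cell₁ (a∈A j) (b∈B j) (b≢β₁ j) v
    disjoint (suc zero) zero v _ = Disjoint-sym disjoint₁₂ v
    disjoint (suc zero) (suc zero) _ i≢j _ _ = i≢j refl
    disjoint (suc zero) (suc (suc zero)) v _ = disjoint₂₃ v
    disjoint (suc zero) (suc (suc (suc j))) v _ = cell-Pair-disjoint cell₂ (a∈A j) (b∈B j) (b≢β₂ j) v
    disjoint (suc (suc zero)) zero v _ = Disjoint-sym disjoint₁₃ v
    disjoint (suc (suc zero)) (suc zero) v _ = Disjoint-sym disjoint₂₃ v
    disjoint (suc (suc zero)) (suc (suc zero)) _ i≢j _ _ = i≢j refl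
    disjoint (suc (suc zero)) (suc (suc (suc j))) v _ = cell-Pair-disjoint cell₃ (a∈A j) (b∈B j) (b≢β₃ j) v
    disjoint (suc (suc (suc i))) zero v _ = Disjoint-sym (cell-Pair-disjoint cell₁ (a∈A i) (b∈B i) (b≢β₁ i)) v
    disjoint (suc (suc (suc i))) (suc zero) v _ = Disjoint-sym (cell-Pair-disjoint cell₂ (a∈A i) (b∈B i) (b≢β₂ i)) v
    disjoint (suc (suc (suc i))) (suc (suc zero)) v _ = Disjoint-sym (cell-Pair-disjoint cell₃ (a∈A i) (b∈B i) (b≢β₃ i)) v
    disjoint (suc (suc (suc i))) (suc (suc (suc j))) v i≢j = pairs-disjoint (λ e → i≢j (cong (λ x → suc (suc (suc x))) e)) v

    edges : ∀ i j → KAdj (4 + k) i j → Touch G (branch i) (branch j)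
    edges zero zero (i≢j , _) = ⊥-elim (i≢j refl)
    edges zero (suc zero) (_ , not-01 , _) = ⊥-elim (not-01 (refl , refl))
    edges zero (suc (suc zero)) _ = touch₁₃
    edges zero (suc (suc (suc j))) _ = cell-Pair-touch cell₁ (a∈A j)
    edges (suc zero) zero (_ , _ , not-10) = ⊥-elim (not-10 (refl , refl))
    edges (suc zero) (suc zero) (i≢j , _) = ⊥-elim (i≢j refl)
    edges (suc zero) (suc (suc zero)) _ = touch₂₃
    edges (suc zero) (suc (suc (suc j))) _ = cell-Pair-touch cell₂ (a∈A j)
    edges (suc (suc zero)) zero _ = Touch-sym G touch₁₃
    edges (suc (suc zero)) (suc zero) _ = Touch-sym G touch₂₃
    edges (suc (suc zero)) (suc (suc zero)) (i≢j , _) = ⊥-elim (i≢j refl)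
    edges (suc (suc zero)) (suc (suc (suc j))) _ = cell-Pair-touch cell₃ (a∈A j)
    edges (suc (suc (suc i))) zero _ = Touch-sym G (cell-Pair-touch cell₁ (a∈A i))
    edges (suc (suc (suc i))) (suc zero) _ = Touch-sym G (cell-Pair-touch cell₂ (a∈A i))
    edges (suc (suc (suc i))) (suc (suc zero)) _ = Touch-sym G (cell-Pair-touch cell₃ (a∈A i))
    edges (suc (suc (suc i))) (suc (suc (suc j))) _ = _ , _ , inj₁ refl , inj₂ refl , A~B (a∈A i) (b∈B j)

    cellPath⇒Kminus : Kminus (4 + k) ≼ G
    cellPath⇒Kminus = record
      { branch = branch ; nonempty = nonempty ; connected = connected ; disjoint = disjoint ; edges = edges }

-- At most two B-vertices in R: rerouting the model through private B-vertices

module _ {m n : ℕ} {H : Graph m} {G : Graph n} {A : Subset n} (M : H ≼ AddClique G A) where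

  open MinorModel M renaming (branch to X)

  MeetsA : Fin m → Set
  MeetsA i = ∃[ a ] X i a × a ∈ A

  free⇒∉A : ∀ {i v} → ¬ MeetsA i → X i v → v ∉ A
  free⇒∉A free x v∈A = free (_ , x , v∈A)

  free-connected : ∀ {i} → ¬ MeetsA i → Connected G (X i)
  free-connected free u v xu xv = addClique-walk G A (free⇒∉A free) (connected _ u v xu xv)

  meeting-branches-≤∣A∣ : ∀ {k} (ι : Fin k → Fin m) → (∀ {i j} → ι i ≡ ι j → i ≡ j) →
    (∀ i → MeetsA (ι i)) → k ≤ ∣ A ∣
  meeting-branches-≤∣A∣ ι ι-injective meets = injective⇒≤∣p∣ A (proj₁ ∘ meets) (proj₂ ∘ proj₂ ∘ meets) a-injective
    where
    a-injective : ∀ {i j} → proj₁ (meets i) ≡ proj₁ (meets j) → i ≡ j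
    a-injective {i} {j} aᵢ≡aⱼ = decidable-stable (i ≟ j) λ i≢j →
      disjoint (ι i) (ι j) _ (i≢j ∘ ι-injective) (proj₁ (proj₂ (meets i)))
        (subst (X (ι j)) (sym aᵢ≡aⱼ) (proj₁ (proj₂ (meets j))))

  module _ (l : Fin m) (l-universal : ∀ i → i ≢ l → Adj H i l) (l-free : ¬ MeetsA l) where

    Reach : Fin n → Set
    Reach = WalkIn G (_∉ A) (proj₁ (nonempty l))

    free⊆Reach : ∀ i → ¬ MeetsA i → ∀ {v} → X i v → Reach v
    free⊆Reach i free {v} xv with i ≟ l | proj₂ (nonempty l)
    ... | yes refl | x₀ = walk-map (free⇒∉A free) (free-connected free _ v x₀ xv)
    ... | no i≢l | x₀ with edges i l (l-universal i i≢l)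
    ... | x , y , xᵢ , yₗ , x~y = walk-++
      (walk-snoc (walk-map (free⇒∉A l-free) (free-connected l-free _ y x₀ yₗ))
        (adj-sym G (addClique-edge G A (free⇒∉A free xᵢ) x~y)) (free⇒∉A free xᵢ))
      (walk-map (free⇒∉A free) (free-connected free x v xᵢ xv))

  module _ {B : Subset n} (A∩B=∅ : Disjoint (_∈ A) (_∈ B)) (A~B : ∀ {a b} → a ∈ A → b ∈ B → Adj G a b)
           (meets? : ∀ i → Dec (MeetsA i))
           {R : Fin n → Set} (R-closed : ∀ {u w} → R u → Adj G u w → w ∉ A → R w)
           (free⊆R : ∀ i → ¬ MeetsA i → ∀ {v} → X i v → R v)
           (f : ∀ {a} → a ∈ A → Fin n) (f∈B : ∀ {a} (a∈A : a ∈ A) → f a∈A ∈ B)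
           (f∉R : ∀ {a} (a∈A : a ∈ A) → ¬ R (f a∈A))
           (f-injective : ∀ {a a′} (a∈A : a ∈ A) (a′∈A : a′ ∈ A) → f a∈A ≡ f a′∈A → a ≡ a′) where

    -- f a is the private B-vertex of a; vertices outside A ∪ R are discarded.
    X′ : Fin m → Fin n → Set
    X′ i v = (X i v × (v ∈ A ⊎ R v)) ⊎ (∃[ a ] Σ (a ∈ A) λ a∈A → X i a × v ≡ f a∈A)

    R-neighbour : ∀ {u w} → R u → Adj G u w → w ∈ A ⊎ R w
    R-neighbour {w = w} ru u~w with w ∈? A
    ... | yes w∈A = inj₁ w∈A
    ... | no w∉A = inj₂ (R-closed ru u~w w∉A)

    module _ {i a₀} (xa₀ : X i a₀) (a₀∈A : a₀ ∈ A) where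

      via-f : ∀ {u} → X i u → u ∈ A → WalkIn G (X′ i) u a₀
      via-f xu u∈A = step (inj₁ (xu , inj₁ u∈A)) (A~B u∈A (f∈B a₀∈A))
        (step (inj₂ (_ , a₀∈A , xa₀ , refl)) (adj-sym G (A~B a₀∈A (f∈B a₀∈A))) (here (inj₁ (xa₀ , inj₁ a₀∈A))))

      walk-to-A : ∀ {u z} → WalkIn (AddClique G A) (X i) u z → z ∈ A → R u → u ∉ A →
        ∃[ a ] a ∈ A × X i a × WalkIn G (X′ i) u a
      walk-to-A (here _) z∈A _ u∉A = ⊥-elim (u∉A z∈A)
      walk-to-A (step {w = w} xu u~w rest) z∈A ru u∉A with w ∈? A
      ... | yes w∈A = w , w∈A , walk-start rest ,
            step (inj₁ (xu , inj₂ ru)) (addClique-edge G A u∉A u~w) (here (inj₁ (walk-start rest , inj₁ w∈A)))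
      ... | no w∉A with walk-to-A rest z∈A (R-closed ru (addClique-edge G A u∉A u~w) w∉A) w∉A
      ...   | a , a∈A , xa , walk = a , a∈A , xa , step (inj₁ (xu , inj₂ ru)) (addClique-edge G A u∉A u~w) walk

      hub-walk : ∀ {u} → X′ i u → WalkIn G (X′ i) u a₀
      hub-walk x′u@(inj₂ (_ , a∈A , _ , refl)) = step x′u (adj-sym G (A~B a₀∈A (f∈B a∈A))) (here (inj₁ (xa₀ , inj₁ a₀∈A)))
      hub-walk (inj₁ (xu , inj₁ u∈A)) = via-f xu u∈A
      hub-walk {u} (inj₁ (xu , inj₂ ru)) with u ∈? A
      ... | yes u∈A = via-f xu u∈A
      ... | no u∉A with walk-to-A (connected i u a₀ xu xa₀) a₀∈A ru u∉A
      ...   | _ , a∈A , xa , walk = walk-++ walk (via-f xa a∈A)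

    X′-nonempty : ∀ i → ∃[ v ] X′ i v
    X′-nonempty i with meets? i | nonempty i
    ... | yes (a , xa , a∈A) | _ = a , inj₁ (xa , inj₁ a∈A)
    ... | no free | v , xv = v , inj₁ (xv , inj₂ (free⊆R i free xv))

    X′-connected : ∀ i → Connected G (X′ i)
    X′-connected i with meets? i
    ... | yes (_ , xa₀ , a₀∈A) = λ u v x′u x′v → walk-++ (hub-walk xa₀ a₀∈A x′u) (walk-reverse (hub-walk xa₀ a₀∈A x′v))
    ... | no free = λ u v x′u x′v →
      walk-map (λ xw → inj₁ (xw , inj₂ (free⊆R i free xw))) (free-connected free u v (X′⇒X x′u) (X′⇒X x′v))
      where
      X′⇒X : ∀ {v} → X′ i v → X i v
      X′⇒X (inj₁ (xv , _)) = xv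
      X′⇒X (inj₂ (a , a∈A , xa , _)) = ⊥-elim (free (a , xa , a∈A))

    f∉A∪R : ∀ {a} (a∈A : a ∈ A) → ¬ (f a∈A ∈ A ⊎ R (f a∈A))
    f∉A∪R a∈A (inj₁ fa∈A) = A∩B=∅ _ fa∈A (f∈B a∈A)
    f∉A∪R a∈A (inj₂ r) = f∉R a∈A r

    X′-disjoint : ∀ i j v → i ≢ j → X′ i v → X′ j v → ⊥
    X′-disjoint i j v i≢j (inj₁ (xi , _)) (inj₁ (xj , _)) = disjoint i j v i≢j xi xj
    X′-disjoint i j v i≢j (inj₁ (_ , v∈A∪R)) (inj₂ (_ , a∈A , _ , refl)) = f∉A∪R a∈A v∈A∪R
    X′-disjoint i j v i≢j (inj₂ (_ , a∈A , _ , refl)) (inj₁ (_ , v∈A∪R)) = f∉A∪R a∈A v∈A∪R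
    X′-disjoint i j v i≢j (inj₂ (a , a∈A , xa , refl)) (inj₂ (_ , a′∈A , xa′ , fa≡fa′)) =
      disjoint i j a i≢j xa (subst (X j) (sym (f-injective a∈A a′∈A fa≡fa′)) xa′)

    X′-edges : ∀ i j → Adj H i j → Touch G (X′ i) (X′ j)
    X′-edges i j i~j with edges i j i~j | meets? i | meets? j
    ... | _ | yes (_ , xa , a∈A) | yes (_ , xa′ , a′∈A) =
      _ , _ , inj₁ (xa , inj₁ a∈A) , inj₂ (_ , a′∈A , xa′ , refl) , A~B a∈A (f∈B a′∈A)
    ... | x , y , xi , yj , x~y | no freeᵢ | _ =
      x , y , inj₁ (xi , inj₂ rx) , inj₁ (yj , R-neighbour rx x~y′) , x~y′
      where
      rx : R x
      rx = free⊆R i freeᵢ xi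
      x~y′ : Adj G x y
      x~y′ = addClique-edge G A (free⇒∉A freeᵢ xi) x~y
    ... | x , y , xi , yj , x~y | yes _ | no freeⱼ =
      x , y , inj₁ (xi , R-neighbour ry (adj-sym G x~y′)) , inj₁ (yj , inj₂ ry) , x~y′
      where
      ry : R y
      ry = free⊆R j freeⱼ yj
      x~y′ : Adj G x y
      x~y′ = adj-sym G (addClique-edge G A (free⇒∉A freeⱼ yj) (adj-sym (AddClique G A) x~y))

    minor-transfer : H ≼ G
    minor-transfer = record
      { branch = X′ ; nonempty = X′-nonempty ; connected = X′-connected ; disjoint = X′-disjoint ; edges = X′-edges }

Kminus-universal : ∀ {k} (j : Fin (2 + k)) i → i ≢ suc (suc j) → Adj (Kminus (4 + k)) i (suc (suc j))
Kminus-universal j i i≢l = i≢l , (λ { (_ , ()) }) , (λ { (_ , ()) })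

module ModelAfterClique {n : ℕ} {G : Graph n} {A B : Subset n}
         (A∩B=∅ : Disjoint (_∈ A) (_∈ B)) (A~B : ∀ {a b} → a ∈ A → b ∈ B → Adj G a b)
         {k : ℕ} (Kminus-free : ¬ (Kminus (4 + k) ≼ G))
         (∣A∣≡1+k : ∣ A ∣ ≡ suc k) (3+∣A∣≤∣B∣ : 3 + ∣ A ∣ ≤ ∣ B ∣)
         (M : Kminus (4 + k) ≼ AddClique G A) (meets? : ∀ i → Dec (MeetsA M i)) where

  some-branch-avoids-A : ∃[ j ] ¬ MeetsA M (suc (suc j))
  some-branch-avoids-A = Finₚ.¬∀⟶∃¬ (2 + k) _ (λ j → meets? (suc (suc j))) λ all-meet →
    ℕₚ.1+n≰n (ℕₚ.≤-trans (meeting-branches-≤∣A∣ M (λ j → suc (suc j)) (Finₚ.suc-injective ∘ Finₚ.suc-injective) all-meet)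
                         (ℕₚ.≤-reflexive ∣A∣≡1+k))

  j : Fin (2 + k)
  j = proj₁ some-branch-avoids-A

  R : Fin n → Set
  R = Reach M (suc (suc j)) (Kminus-universal j) (proj₂ some-branch-avoids-A)

  free⊆R : ∀ i → ¬ MeetsA M i → ∀ {v} → MinorModel.branch M i v → R v
  free⊆R = free⊆Reach M (suc (suc j)) (Kminus-universal j) (proj₂ some-branch-avoids-A)

  R-walk : ∀ {x y} → R x → R y → WalkIn G (_∉ A) x y
  R-walk rx ry = walk-++ (walk-reverse rx) ry

  module _ (R? : ∀ v → Dec (R v)) where

    B∩R B─R : Subset n
    B∩R = B ∩ toSubset R?
    B─R = B ─ toSubset R?

    many-B-in-R : 3 ≤ ∣ B∩R ∣ → ⊥
    many-B-in-R 3≤∣B∩R∣ = Kminus-free (CellPathModel.cellPath⇒Kminus A∩B=∅ A~B ∣A∣≡1+k 3+∣A∣≤∣B∣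
      (cellPath-in-region G A B R-walk b (embed-injective B∩R 3≤∣B∩R∣) (proj₁ ∘ b∈B∩R) (∈toSubset⁻ R? ∘ proj₂ ∘ b∈B∩R)))
      where
      b : Fin 3 → Fin n
      b = embed B∩R 3≤∣B∩R∣
      b∈B∩R : ∀ i → b i ∈ B × b i ∈ toSubset R?
      b∈B∩R i = x∈p∩q⁻ B _ (embed-∈ B∩R 3≤∣B∩R∣ i)

    few-B-in-R : ∣ B∩R ∣ ≤ 2 → ⊥
    few-B-in-R ∣B∩R∣≤2 = Kminus-free (minor-transfer M A∩B=∅ A~B meets? walk-snoc
      free⊆R f (p─q⊆p B _ ∘ f∈B─R)
      (λ a∈A r → x∈p─q⇒x∉q (f∈B─R a∈A) (∈toSubset⁺ R? r))
      (λ a∈A a′∈A fa≡fa′ → rank-injective A a∈A a′∈A (embed-injective B─R ∣A∣≤∣B─R∣ fa≡fa′)))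
      where
      ∣A∣≤∣B─R∣ : ∣ A ∣ ≤ ∣ B─R ∣
      ∣A∣≤∣B─R∣ = ℕₚ.+-cancelˡ-≤ 2 _ _ (begin
        2 + ∣ A ∣          ≤⟨ ℕₚ.n≤1+n _ ⟩
        3 + ∣ A ∣          ≤⟨ 3+∣A∣≤∣B∣ ⟩
        ∣ B ∣              ≡⟨ ∣p∣≡∣p∩q∣+∣p─q∣ B _ ⟩
        ∣ B∩R ∣ + ∣ B─R ∣  ≤⟨ ℕₚ.+-monoˡ-≤ _ ∣B∩R∣≤2 ⟩
        2 + ∣ B─R ∣        ∎)
        where open ℕₚ.≤-Reasoning
      f : ∀ {a} → a ∈ A → Fin n
      f a∈A = embed B─R ∣A∣≤∣B─R∣ (rank A a∈A)
      f∈B─R : ∀ {a} (a∈A : a ∈ A) → f a∈A ∈ B─R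
      f∈B─R a∈A = embed-∈ B─R ∣A∣≤∣B─R∣ (rank A a∈A)

    contradiction : ⊥
    contradiction with ∣ B∩R ∣ ≤? 2
    ... | yes ∣B∩R∣≤2 = few-B-in-R ∣B∩R∣≤2
    ... | no ∣B∩R∣≰2 = many-B-in-R (ℕₚ.≰⇒> ∣B∩R∣≰2)

clique-on-A-keeps-Kminus-free : ∀ {n} {G : Graph n} {A B : Subset n} → Disjoint (_∈ A) (_∈ B) →
  (∀ {a b} → a ∈ A → b ∈ B → Adj G a b) → ∀ {k} → ¬ (Kminus (4 + k) ≼ G) →
  ∣ A ∣ ≡ suc k → 3 + ∣ A ∣ ≤ ∣ B ∣ → ¬ (Kminus (4 + k) ≼ AddClique G A)
clique-on-A-keeps-Kminus-free A∩B=∅ A~B Kminus-free ∣A∣≡1+k 3+∣A∣≤∣B∣ M =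
  ¬¬-decide-Fin (MeetsA M) λ meets? →
  let open ModelAfterClique A∩B=∅ A~B Kminus-free ∣A∣≡1+k 3+∣A∣≤∣B∣ M meets? in
  ¬¬-decide-Fin R contradiction

ℕ→ℚ≡mkℚ : ∀ k → ℕ→ℚ k ≡ mkℚ (+ k) 0 (Coprime.sym (Coprime.1-coprimeTo k))
ℕ→ℚ≡mkℚ k = ℚₚ.normalize-coprime _

0≤ℕ→ℚ : ∀ k → 0ℚ ≤ℚ ℕ→ℚ k
0≤ℕ→ℚ k rewrite ℕ→ℚ≡mkℚ k = *≤* (subst (+ 0 ℤ.≤_) (sym (ℤₚ.*-identityʳ (+ k))) (ℤ.+≤+ ℕ.z≤n))

ℕ→ℚ-cancel-< : ∀ {a b} → ℕ→ℚ a <ℚ ℕ→ℚ b → a < b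
ℕ→ℚ-cancel-< {a} {b} a<b rewrite ℕ→ℚ≡mkℚ a | ℕ→ℚ≡mkℚ b =
  ℤₚ.drop‿+<+ (subst₂ ℤ._<_ (ℤₚ.*-identityʳ (+ a)) (ℤₚ.*-identityʳ (+ b)) (ℚₚ.drop-*<* a<b))

size-bound : ∀ r n b (δ : ℚ) → 0ℚ ≤ℚ δ → ℕ→ℚ b ≡ (1ℚ -ℚ δ) *ℚ ℕ→ℚ n →
  ℕ→ℚ r <ℚ (1ℚ -ℚ (ℕ→ℚ 3 *ℚ δ)) *ℚ ℕ→ℚ n → r < b
size-bound r n b δ 0≤δ b≡ r< = ℕ→ℚ-cancel-< (begin-strict
  ℕ→ℚ r                          <⟨ r< ⟩
  (1ℚ -ℚ (ℕ→ℚ 3 *ℚ δ)) *ℚ ℕ→ℚ n  ≤⟨ ℚₚ.*-monoʳ-≤-nonNeg (ℕ→ℚ n) (ℚₚ.+-monoʳ-≤ 1ℚ (ℚₚ.neg-antimono-≤ δ≤3δ)) ⟩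
  (1ℚ -ℚ δ) *ℚ ℕ→ℚ n             ≡⟨ b≡ ⟨
  ℕ→ℚ b                          ∎)
  where
  open ℚₚ.≤-Reasoning
  instance
    δ-nonNeg : NonNegative δ
    δ-nonNeg = nonNegative 0≤δ
    n-nonNeg : NonNegative (ℕ→ℚ n)
    n-nonNeg = nonNegative (0≤ℕ→ℚ n)
  1≤3 : 1ℚ ≤ℚ ℕ→ℚ 3
  1≤3 = *≤* (ℤ.+≤+ (s≤s ℕ.z≤n))
  δ≤3δ : δ ≤ℚ ℕ→ℚ 3 *ℚ δ
  δ≤3δ = subst (_≤ℚ ℕ→ℚ 3 *ℚ δ) (ℚₚ.*-identityˡ δ) (ℚₚ.*-monoʳ-≤-nonNeg δ 1≤3)

theorem3p2 : (r n : ℕ) → 4 ≤ r → (G : Graph n) → ¬ (Kminus r ≼ G)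
    → (A B : Subset n) → (∀ v → v ∈ A → v ∈ B → ⊥)
    → ∣ A ∣ ≡ r ∸ 3
    → (δ : ℚ) → 0ℚ ≤ℚ δ
    → ℕ→ℚ ∣ B ∣ ≡ (1ℚ -ℚ δ) *ℚ ℕ→ℚ n
    → ℕ→ℚ r <ℚ (1ℚ -ℚ (ℕ→ℚ 3 *ℚ δ)) *ℚ ℕ→ℚ n
    → (∀ a b → a ∈ A → b ∈ B → Adj G a b)
    → ¬ (Kminus r ≼ AddClique G A)
theorem3p2 zero _ ()
theorem3p2 (suc zero) _ (s≤s ())
theorem3p2 (suc (suc zero)) _ (s≤s (s≤s ()))
theorem3p2 (suc (suc (suc zero))) _ (s≤s (s≤s (s≤s ())))
theorem3p2 (suc (suc (suc (suc k)))) n _ G Kminus-free A B A∩B=∅ ∣A∣≡1+k δ 0≤δ ∣B∣≡ r< A~B =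
  clique-on-A-keeps-Kminus-free A∩B=∅ (λ {a} {b} → A~B a b) Kminus-free ∣A∣≡1+k
    (subst (λ x → 3 + x ≤ ∣ B ∣) (sym ∣A∣≡1+k) (ℕₚ.<⇒≤ (size-bound _ n ∣ B ∣ δ 0≤δ ∣B∣≡ r<)))
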